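{- For $x \in \mathbb{C}$ and $n\in\mathbb{N}_0$, $$\sum_{k=1}^n k^3 H_k^{(3)}(x) = \frac{(n-x)(x+n+1)(x^2+x+n+n^2)}{4} H_n^{(3)}(x) + \frac{x(x+1)(2x+1)}{2} H_n^{(2)}(x) - \frac{6x^2+6x+1}{4} H_n(x) + \frac{(6x+3-n)n}{8}.$$
   Context: For $x\in\mathbb{C}$, $l,n\in\mathbb{N}_0$, $H_0^{(l)}(x)=0$ and $H_n^{(l)}(x)=\sum_{k=1}^n \frac{1}{(x+k)^l}$ for $n\ge 1$ (defined whenever $x$ is not one of $-1,\dots,-n$); $H_n(x)=H_n^{(1)}(x)$. -}

module Defs where

open import Level using (Level; _⊔_)
open import Data.Nat using (ℕ; zero; suc)
open import Relation.Nullary using (¬_)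
open import Algebra.Bundles using (CommutativeRing)

-- A field: a commutative ring with 0 ≠ 1 and a multiplicative inverse
-- for every nonzero element (the value of _⁻¹ at 0 is irrelevant).
record Field (c ℓ : Level) : Set (Level.suc (c ⊔ ℓ)) where
  field
    commutativeRing : CommutativeRing c ℓ
  open CommutativeRing commutativeRing public
  field
    _⁻¹      : Carrier → Carrier
    0≉1      : ¬ (0# ≈ 1#)
    inverseʳ : ∀ a → ¬ (a ≈ 0#) → a * (a ⁻¹) ≈ 1#

module FieldOps {c ℓ : Level} (F : Field c ℓ) where
  open Field F public

  ι : ℕ → Carrier
  ι zero    = 0#
  ι (suc m) = 1# + ι m

  infixr 8 _^_
  _^_ : Carrier → ℕ → Carrier
  a ^ zero  = 1#
  a ^ suc m = a * (a ^ m)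

  CharZero : Set ℓ
  CharZero = ∀ m → ¬ (ι (suc m) ≈ 0#)

  H : ℕ → ℕ → Carrier → Carrier
  H l zero    x = 0#
  H l (suc n) x = H l n x + ((x + ι (suc n)) ^ l) ⁻¹

  S : ℕ → Carrier → Carrier
  S zero    x = 0#
  S (suc n) x = S n x + (ι (suc n) ^ 3) * H 3 (suc n) x

-- Both sides vanish at n = 0, so it suffices that R
-- obeys the recurrence of the left side, R (n+1) = R n + (n+1)³ H_{n+1}⁽³⁾.
-- Writing H_{n+1}⁽ˡ⁾ = H_n⁽ˡ⁾ + u^l with u = 1/(x+n+1), this splits into
--   (a) the H⁽³⁾-coefficient α n satisfies α (n+1) = α n + (n+1)³, and
--   (b) the terms in u cancel: α n u³ + β u² − γ u + (δ (n+1) − δ n) = 0.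
-- Multiplying (b) by y³ = (x+n+1)³ turns it into a polynomial identity in x
-- and n (`numerator-identity`); `reverse-cubic` transfers it back to u.
module Submission where

open import Defs
open import Level using (Level)
open import Algebra.Bundles using (CommutativeRing)
open import Data.Nat as ℕ using (ℕ; zero; suc; _≤_)
import Data.Nat.Properties as ℕ
open import Data.Integer as ℤ using (ℤ; +_; -[1+_])
import Data.Integer.Properties as ℤ
open import Data.Sign as Sign using (Sign)
open import Data.Maybe using (Maybe; just; nothing)
open import Relation.Nullary using (¬_; yes; no)
import Relation.Binary.PropositionalEquality as ≡
open import Algebra.Solver.Ring.AlmostCommutativeRing
  using (fromCommutativeRing; _-Raw-AlmostCommutative⟶_)

-- Every commutative ring receives a ring homomorphism from ℤ; this is
-- what lets the standard ring solver normalise polynomial identities with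
-- integer coefficients in an arbitrary commutative ring.
module IntegerCoefficients {c ℓ : Level} (R : CommutativeRing c ℓ) where
  open CommutativeRing R
  open import Algebra.Properties.Ring ring using (-1*x≈-x)
  open import Algebra.Properties.AbelianGroup +-abelianGroup using (⁻¹-∙-comm; ε⁻¹≈ε; ⁻¹-involutive)
  open import Algebra.Properties.Semiring.Mult.TCOptimised semiring using (_×_; 1+×; ×-homo-+; ×1-homo-*)
  open import Algebra.Properties.CommutativeSemigroup +-commutativeSemigroup using () renaming (interchange to +-interchange)
  open import Algebra.Properties.CommutativeSemigroup *-commutativeSemigroup using () renaming (interchange to *-interchange)
  open import Relation.Binary.Reasoning.Setoid setoid

  ν : ℕ → Carrier
  ν n = n × 1#

  ⟦_⟧ℤ : ℤ → Carrier
  ⟦ + n ⟧ℤ = ν n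
  ⟦ -[1+ n ] ⟧ℤ = - ν (suc n)

  -‿+ : ∀ a b → - (a + b) ≈ - a + - b
  -‿+ a b = sym (⁻¹-∙-comm a b)

  ⟦⊖⟧ : ∀ m n → ⟦ m ℤ.⊖ n ⟧ℤ ≈ ν m - ν n
  ⟦⊖⟧ m zero = sym (trans (+-congˡ ε⁻¹≈ε) (+-identityʳ (ν m)))
  ⟦⊖⟧ zero (suc n) = sym (+-identityˡ _)
  ⟦⊖⟧ (suc m) (suc n) = begin
    ⟦ suc m ℤ.⊖ suc n ⟧ℤ         ≡⟨ ≡.cong ⟦_⟧ℤ (ℤ.[1+m]⊖[1+n]≡m⊖n m n) ⟩
    ⟦ m ℤ.⊖ n ⟧ℤ                 ≈⟨ ⟦⊖⟧ m n ⟩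
    ν m - ν n                    ≈⟨ +-identityˡ _ ⟨
    0# + (ν m - ν n)             ≈⟨ +-congʳ (-‿inverseʳ 1#) ⟨
    (1# - 1#) + (ν m - ν n)      ≈⟨ +-interchange _ _ _ _ ⟩
    (1# + ν m) + (- 1# + - ν n)  ≈⟨ +-congˡ (-‿+ 1# (ν n)) ⟨
    (1# + ν m) - (1# + ν n)      ≈⟨ +-cong (1+× m 1#) (-‿cong (1+× n 1#)) ⟨
    ν (suc m) - ν (suc n)        ∎

  ⟦+⟧ : ∀ i j → ⟦ i ℤ.+ j ⟧ℤ ≈ ⟦ i ⟧ℤ + ⟦ j ⟧ℤ
  ⟦+⟧ (+ m) (+ n) = ×-homo-+ 1# m n
  ⟦+⟧ (+ m) -[1+ n ] = ⟦⊖⟧ m (suc n)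
  ⟦+⟧ -[1+ m ] (+ n) = trans (⟦⊖⟧ n (suc m)) (+-comm _ _)
  ⟦+⟧ -[1+ m ] -[1+ n ] = begin
    - ν (suc (suc (m ℕ.+ n)))   ≡⟨ ≡.cong (λ k → - ν (suc k)) (ℕ.+-suc m n) ⟨
    - ν (suc m ℕ.+ suc n)       ≈⟨ -‿cong (×-homo-+ 1# (suc m) (suc n)) ⟩
    - (ν (suc m) + ν (suc n))   ≈⟨ -‿+ _ _ ⟩
    - ν (suc m) + - ν (suc n)   ∎

  ⟦-⟧ : ∀ i → ⟦ ℤ.- i ⟧ℤ ≈ - ⟦ i ⟧ℤ
  ⟦-⟧ (+ zero) = sym ε⁻¹≈ε
  ⟦-⟧ (+ suc n) = refl
  ⟦-⟧ -[1+ n ] = sym (⁻¹-involutive _)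

  -- Multiplication is handled through the sign–magnitude decomposition.
  ⟦_⟧± : Sign → Carrier
  ⟦ Sign.+ ⟧± = 1#
  ⟦ Sign.- ⟧± = - 1#

  ⟦*⟧± : ∀ s t → ⟦ s Sign.* t ⟧± ≈ ⟦ s ⟧± * ⟦ t ⟧±
  ⟦*⟧± Sign.+ Sign.+ = sym (*-identityˡ _)
  ⟦*⟧± Sign.+ Sign.- = sym (*-identityˡ _)
  ⟦*⟧± Sign.- Sign.+ = sym (*-identityʳ _)
  ⟦*⟧± Sign.- Sign.- = sym (trans (-1*x≈-x _) (⁻¹-involutive _))

  ⟦◃⟧ : ∀ s n → ⟦ s ℤ.◃ n ⟧ℤ ≈ ⟦ s ⟧± * ν n
  ⟦◃⟧ s zero = sym (zeroʳ _)
  ⟦◃⟧ Sign.+ (suc n) = sym (*-identityˡ _)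
  ⟦◃⟧ Sign.- (suc n) = sym (-1*x≈-x _)

  sign-magnitude : ∀ i → ⟦ i ⟧ℤ ≈ ⟦ ℤ.sign i ⟧± * ν ℤ.∣ i ∣
  sign-magnitude i = trans (reflexive (≡.cong ⟦_⟧ℤ (≡.sym (ℤ.◃-inverse i)))) (⟦◃⟧ (ℤ.sign i) ℤ.∣ i ∣)

  ⟦*⟧ : ∀ i j → ⟦ i ℤ.* j ⟧ℤ ≈ ⟦ i ⟧ℤ * ⟦ j ⟧ℤ
  ⟦*⟧ i j = begin
    ⟦ i ℤ.* j ⟧ℤ                                    ≈⟨ ⟦◃⟧ (ℤ.sign i Sign.* ℤ.sign j) (ℤ.∣ i ∣ ℕ.* ℤ.∣ j ∣) ⟩
    ⟦ ℤ.sign i Sign.* ℤ.sign j ⟧± * ν (ℤ.∣ i ∣ ℕ.* ℤ.∣ j ∣)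
      ≈⟨ *-cong (⟦*⟧± (ℤ.sign i) (ℤ.sign j)) (×1-homo-* ℤ.∣ i ∣ ℤ.∣ j ∣) ⟩
    (⟦ ℤ.sign i ⟧± * ⟦ ℤ.sign j ⟧±) * (ν ℤ.∣ i ∣ * ν ℤ.∣ j ∣) ≈⟨ *-interchange _ _ _ _ ⟩
    (⟦ ℤ.sign i ⟧± * ν ℤ.∣ i ∣) * (⟦ ℤ.sign j ⟧± * ν ℤ.∣ j ∣) ≈⟨ *-cong (sign-magnitude i) (sign-magnitude j) ⟨
    ⟦ i ⟧ℤ * ⟦ j ⟧ℤ                                  ∎

  homomorphism : ℤ.+-*-rawRing -Raw-AlmostCommutative⟶ fromCommutativeRing R
  homomorphism = record
    { ⟦_⟧    = ⟦_⟧ℤ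
    ; +-homo = ⟦+⟧
    ; *-homo = ⟦*⟧
    ; -‿homo = ⟦-⟧
    ; 0-homo = refl
    ; 1-homo = refl
    }

  coefficient-equality : ∀ i j → Maybe (⟦ i ⟧ℤ ≈ ⟦ j ⟧ℤ)
  coefficient-equality i j with i ℤ.≟ j
  ... | yes ≡.refl = just refl
  ... | no _ = nothing

  open import Algebra.Solver.Ring ℤ.+-*-rawRing (fromCommutativeRing R) homomorphism coefficient-equality public
    using (solve; _:=_; Polynomial; con; _:+_; _:*_; :-_; _:-_; _:^_; _:×_)

  -- Constants for solver expressions: `one` evaluates to 1#, and `num j` to
  -- 1# + (1# + ... + 0#), which is literally the canonical image ι j of a field.
  one : ∀ {k} → Polynomial k
  one = con (+ 1)

  num : ∀ {k} → ℕ → Polynomial k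
  num j = j :× one

module FieldFacts {c ℓ : Level} (F : Field c ℓ) where
  open FieldOps F
  open IntegerCoefficients commutativeRing
  open import Relation.Binary.Reasoning.Setoid setoid

  inverse-unique : ∀ {a b} → a * b ≈ 1# → b ≈ a ⁻¹
  inverse-unique {a} {b} ab≈1 = begin
    b                  ≈⟨ *-identityʳ b ⟨
    b * 1#             ≈⟨ *-congˡ (inverseʳ a a≉0) ⟨
    b * (a * a ⁻¹)     ≈⟨ solve 3 (λ A B A⁻¹ → B :* (A :* A⁻¹) := (A :* B) :* A⁻¹) refl a b (a ⁻¹) ⟩
    (a * b) * a ⁻¹     ≈⟨ *-congʳ ab≈1 ⟩
    1# * a ⁻¹          ≈⟨ *-identityˡ _ ⟩
    a ⁻¹               ∎
    where
    a≉0 : ¬ (a ≈ 0#)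
    a≉0 a≈0 = 0≉1 (trans (sym (zeroˡ b)) (trans (*-congʳ (sym a≈0)) ab≈1))

  ^-distrib-* : ∀ a b l → (a * b) ^ l ≈ a ^ l * b ^ l
  ^-distrib-* a b zero = sym (*-identityˡ 1#)
  ^-distrib-* a b (suc l) = begin
    (a * b) * (a * b) ^ l        ≈⟨ *-congˡ (^-distrib-* a b l) ⟩
    (a * b) * (a ^ l * b ^ l)    ≈⟨ solve 4 (λ A B P Q → (A :* B) :* (P :* Q) := (A :* P) :* (B :* Q)) refl a b (a ^ l) (b ^ l) ⟩
    (a * a ^ l) * (b * b ^ l)    ∎

  1^ : ∀ l → 1# ^ l ≈ 1#
  1^ zero = refl
  1^ (suc l) = trans (*-identityˡ _) (1^ l)

  inverse-^ : ∀ {a} → ¬ (a ≈ 0#) → ∀ l → (a ^ l) ⁻¹ ≈ (a ⁻¹) ^ l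
  inverse-^ {a} a≉0 l = sym (inverse-unique (begin
    a ^ l * (a ⁻¹) ^ l    ≈⟨ ^-distrib-* a (a ⁻¹) l ⟨
    (a * a ⁻¹) ^ l        ≈⟨ ^-cong (inverseʳ a a≉0) l ⟩
    1# ^ l                ≈⟨ 1^ l ⟩
    1#                    ∎))
    where
    ^-cong : ∀ {p q} → p ≈ q → ∀ l → p ^ l ≈ q ^ l
    ^-cong p≈q zero = refl
    ^-cong p≈q (suc l) = *-cong p≈q (^-cong p≈q l)

  inverse-factor : ∀ {a b c w} → a * b ≈ c → c * w ≈ 1# → a ⁻¹ ≈ b * w
  inverse-factor {a} {b} {c} {w} ab≈c cw≈1 = sym (inverse-unique (begin
    a * (b * w)    ≈⟨ *-assoc a b w ⟨
    (a * b) * w    ≈⟨ *-congʳ ab≈c ⟩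
    c * w          ≈⟨ cw≈1 ⟩
    1#             ∎))

  scaled-step : ∀ {p p′ q c w t} → p′ ≈ p + q * c → c * w ≈ t → p′ * w ≈ p * w + q * t
  scaled-step {p} {p′} {q} {c} {w} {t} p′≈ cw≈t = begin
    p′ * w              ≈⟨ *-congʳ p′≈ ⟩
    (p + q * c) * w     ≈⟨ solve 4 (λ P Q C W → (P :+ Q :* C) :* W := P :* W :+ Q :* (C :* W)) refl p q c w ⟩
    p * w + q * (c * w) ≈⟨ +-congˡ (*-congˡ cw≈t) ⟩
    p * w + q * t       ∎

  -- A cubic relation for y becomes one for its inverse u by reversing the
  -- coefficients: u³ (a + b y + c y² + d y³) = a u³ + b u² + c u + d when y u = 1.
  reverse-cubic : ∀ {y u} a b c d → y * u ≈ 1# →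
    a + b * y + c * y ^ 2 + d * y ^ 3 ≈ 0# → a * u ^ 3 + b * u ^ 2 + c * u + d ≈ 0#
  reverse-cubic {y} {u} a b c d yu≈1 cubic≈0 = begin
    a * u ^ 3 + b * u ^ 2 + c * u + d
      ≈⟨ solve 6 (λ A B C D Y U →
           A :* U :^ 3 :+ B :* U :^ 2 :+ C :* U :+ D
           := (A :+ B :* Y :+ C :* Y :^ 2 :+ D :* Y :^ 3) :* U :^ 3
              :+ (B :* U :^ 2 :+ C :* U :* (one :+ Y :* U)
                  :+ D :* (one :+ Y :* U :+ (Y :* U) :^ 2)) :* (one :- Y :* U))
         refl a b c d y u ⟩
    (a + b * y + c * y ^ 2 + d * y ^ 3) * u ^ 3 + remainder * (1# - y * u)
      ≈⟨ +-cong (*-congʳ cubic≈0) (*-congˡ (+-congˡ (-‿cong yu≈1))) ⟩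
    0# * u ^ 3 + remainder * (1# - 1#)
      ≈⟨ +-cong (zeroˡ _) (trans (*-congˡ (-‿inverseʳ 1#)) (zeroʳ _)) ⟩
    0# + 0#
      ≈⟨ +-identityʳ 0# ⟩
    0# ∎
    where
    remainder : Carrier
    remainder = b * u ^ 2 + c * u * (1# + y * u) + d * (1# + y * u + (y * u) ^ 2)

module ClosedForm {c ℓ : Level} (F : Field c ℓ) (charZero : FieldOps.CharZero F) (x : FieldOps.Carrier F) where
  open FieldOps F
  open IntegerCoefficients commutativeRing
  open FieldFacts F
  open import Relation.Binary.Reasoning.Setoid setoid

  quarter half eighth : Carrier
  quarter = ι 4 ⁻¹
  half = ι 2 ⁻¹
  eighth = ι 8 ⁻¹

  P : ℕ → Carrier
  P n = (ι n - x) * (x + ι n + 1#) * (x ^ 2 + x + ι n + ι n ^ 2)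

  B C : Carrier
  B = x * (x + 1#) * (ι 2 * x + 1#)
  C = ι 6 * x ^ 2 + ι 6 * x + 1#

  D : ℕ → Carrier
  D n = (ι 6 * x + ι 3 - ι n) * ι n

  R : ℕ → Carrier
  R n = (P n * quarter) * H 3 n x + (B * half) * H 2 n x - (C * quarter) * H 1 n x + D n * eighth

  4*quarter : ι 4 * quarter ≈ 1#
  4*quarter = inverseʳ (ι 4) (charZero 3)

  half≈2*quarter : half ≈ ι 2 * quarter
  half≈2*quarter = inverse-factor (solve 0 (num 2 :* num 2 := num 4) refl) 4*quarter

  2*eighth : ι 2 * eighth ≈ quarter
  2*eighth = sym (inverse-factor (solve 0 (num 4 :* num 2 := num 8) refl)
                                 (inverseʳ (ι 8) (charZero 7)))

  P-step : ∀ n → P (suc n) ≈ P n + ι (suc n) ^ 3 * ι 4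
  P-step n = solve 2 (λ X M → let M′ = one :+ M in
      (M′ :- X) :* (X :+ M′ :+ one) :* (X :^ 2 :+ X :+ M′ :+ M′ :^ 2)
      := (M :- X) :* (X :+ M :+ one) :* (X :^ 2 :+ X :+ M :+ M :^ 2) :+ M′ :^ 3 :* num 4)
    refl x (ι n)

  E : ℕ → Carrier
  E n = ι 3 * x + 1# - ι n

  D-step : ∀ n → D (suc n) ≈ D n + E n * ι 2
  D-step n = solve 2 (λ X M → let M′ = one :+ M in
      (num 6 :* X :+ num 3 :- M′) :* M′
      := (num 6 :* X :+ num 3 :- M) :* M
         :+ (num 3 :* X :+ one :- M) :* num 2)
    refl x (ι n)

  numerator-identity : ∀ n → let y = x + ι (suc n) in
    P n + ι 2 * B * y - C * y ^ 2 + E n * y ^ 3 ≈ 0#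
  numerator-identity n = solve 2 (λ X M → let Y = X :+ (one :+ M) in
      (M :- X) :* (X :+ M :+ one) :* (X :^ 2 :+ X :+ M :+ M :^ 2)
      :+ num 2 :* (X :* (X :+ one) :* (num 2 :* X :+ one)) :* Y
      :- (num 6 :* X :^ 2 :+ num 6 :* X :+ one) :* Y :^ 2
      :+ (num 3 :* X :+ one :- M) :* Y :^ 3
      := con (+ 0))
    refl x (ι n)

  α-step : ∀ n → P (suc n) * quarter ≈ P n * quarter + ι (suc n) ^ 3
  α-step n = trans (scaled-step (P-step n) 4*quarter) (+-congˡ (*-identityʳ _))

  δ-step : ∀ n → D (suc n) * eighth ≈ D n * eighth + E n * quarter
  δ-step n = scaled-step (D-step n) 2*eighth

  new-terms-vanish : ∀ n → let y = x + ι (suc n) in ¬ (y ≈ 0#) →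
    (P n * quarter) * (y ^ 3) ⁻¹ + (B * half) * (y ^ 2) ⁻¹ + (- (C * quarter)) * (y ^ 1) ⁻¹
      + E n * quarter ≈ 0#
  new-terms-vanish n y≉0 = begin
    (P n * quarter) * (y ^ 3) ⁻¹ + (B * half) * (y ^ 2) ⁻¹ + (- (C * quarter)) * (y ^ 1) ⁻¹ + E n * quarter
      ≈⟨ +-congʳ (+-cong (+-cong (*-congˡ (inverse-^ y≉0 3)) (*-congˡ (inverse-^ y≉0 2)))
                         (*-congˡ (trans (inverse-^ y≉0 1) (*-identityʳ _)))) ⟩
    (P n * quarter) * u ^ 3 + (B * half) * u ^ 2 + (- (C * quarter)) * u + E n * quarter
      ≈⟨ reverse-cubic _ _ _ _ (inverseʳ y y≉0) cubic ⟩
    0# ∎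
    where
    y u : Carrier
    y = x + ι (suc n)
    u = y ⁻¹

    cubic : P n * quarter + (B * half) * y + (- (C * quarter)) * y ^ 2 + (E n * quarter) * y ^ 3 ≈ 0#
    cubic = begin
      P n * quarter + (B * half) * y + (- (C * quarter)) * y ^ 2 + (E n * quarter) * y ^ 3
        ≈⟨ +-congʳ (+-congʳ (+-congˡ (*-congʳ (*-congˡ half≈2*quarter)))) ⟩
      P n * quarter + (B * (ι 2 * quarter)) * y + (- (C * quarter)) * y ^ 2 + (E n * quarter) * y ^ 3
        ≈⟨ solve 6 (λ Pn Bx Cx En Q Y →
             Pn :* Q :+ (Bx :* (num 2 :* Q)) :* Y :+ (:- (Cx :* Q)) :* Y :^ 2 :+ (En :* Q) :* Y :^ 3
             := (Pn :+ num 2 :* Bx :* Y :- Cx :* Y :^ 2 :+ En :* Y :^ 3) :* Q)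
           refl (P n) B C (E n) quarter y ⟩
      (P n + ι 2 * B * y - C * y ^ 2 + E n * y ^ 3) * quarter
        ≈⟨ *-congʳ (numerator-identity n) ⟩
      0# * quarter
        ≈⟨ zeroˡ quarter ⟩
      0# ∎

  R-step : ∀ n → ¬ (x + ι (suc n) ≈ 0#) → R (suc n) ≈ R n + ι (suc n) ^ 3 * H 3 (suc n) x
  R-step n y≉0 = begin
    R (suc n)
      ≈⟨ +-cong (+-congʳ (+-congʳ (*-congʳ (α-step n)))) (δ-step n) ⟩
    (α + k) * (h₃ + w 3) + β * (h₂ + w 2) - γ * (h₁ + w 1) + (δ + e)
      ≈⟨ solve 12 (λ A K Bt G Dt Et H₁ H₂ H₃ W₁ W₂ W₃ →
           (A :+ K) :* (H₃ :+ W₃) :+ Bt :* (H₂ :+ W₂) :- G :* (H₁ :+ W₁) :+ (Dt :+ Et)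
           := (A :* H₃ :+ Bt :* H₂ :- G :* H₁ :+ Dt :+ K :* (H₃ :+ W₃))
              :+ (A :* W₃ :+ Bt :* W₂ :+ (:- G) :* W₁ :+ Et))
         refl α k β γ δ e h₁ h₂ h₃ (w 1) (w 2) (w 3) ⟩
    (R n + k * H 3 (suc n) x) + (α * w 3 + β * w 2 + (- γ) * w 1 + e)
      ≈⟨ +-congˡ (new-terms-vanish n y≉0) ⟩
    (R n + k * H 3 (suc n) x) + 0#
      ≈⟨ +-identityʳ _ ⟩
    R n + k * H 3 (suc n) x ∎
    where
    α β γ δ e k h₁ h₂ h₃ : Carrier
    α = P n * quarter
    β = B * half
    γ = C * quarter
    δ = D n * eighth
    e = E n * quarter
    k = ι (suc n) ^ 3
    h₁ = H 1 n x
    h₂ = H 2 n x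
    h₃ = H 3 n x

    w : ℕ → Carrier
    w l = ((x + ι (suc n)) ^ l) ⁻¹

  R-zero : R 0 ≈ 0#
  R-zero = solve 5 (λ A Bt G Dt Q → A :* con (+ 0) :+ Bt :* con (+ 0) :- G :* con (+ 0) :+ Dt :* con (+ 0) :* Q
                                    := con (+ 0))
             refl (P 0 * quarter) (B * half) (C * quarter) (ι 6 * x + ι 3 - 0#) eighth

proposition17 : {c ℓ : Level} (F : Field c ℓ) → let open FieldOps F in
    CharZero → (x : Carrier) (n : ℕ) →
    (∀ k → 1 ≤ k → k ≤ n → ¬ (x + ι k ≈ 0#)) →
    S n x ≈
      ((ι n - x) * (x + ι n + 1#) * (x ^ 2 + x + ι n + ι n ^ 2) * (ι 4 ⁻¹)) * H 3 n x
      + (x * (x + 1#) * (ι 2 * x + 1#) * (ι 2 ⁻¹)) * H 2 n x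
      - ((ι 6 * x ^ 2 + ι 6 * x + 1#) * (ι 4 ⁻¹)) * H 1 n x
      + (ι 6 * x + ι 3 - ι n) * ι n * (ι 8 ⁻¹)
proposition17 F charZero x zero _ = sym R-zero
  where open FieldOps F
        open ClosedForm F charZero x
proposition17 F charZero x (suc n) nonzero = begin
    S (suc n) x                              ≈⟨ +-congʳ induction-hypothesis ⟩
    R n + ι (suc n) ^ 3 * H 3 (suc n) x      ≈⟨ R-step n (nonzero (suc n) (ℕ.s≤s ℕ.z≤n) ℕ.≤-refl) ⟨
    R (suc n)                                ∎
  where
  open FieldOps F
  open ClosedForm F charZero x
  open import Relation.Binary.Reasoning.Setoid setoid

  induction-hypothesis : S n x ≈ R n
  induction-hypothesis = proposition17 F charZero x n (λ k 1≤k k≤n → nonzero k 1≤k (ℕ.m≤n⇒m≤1+n k≤n))
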